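{- Let $f\colon\mathbb Z_p\to\mathbb Z_p$ be uniformly differentiable modulo $p$ on $\mathbb Z_p$. If $f$ is asymptotically measure-preserving, then $\|f'_1(u)\|_p\ge 1$ for all $u\in\mathbb Z_p$, where $f'_1(u)$ denotes the derivative modulo $p$ of $f$ at $u$.
   Context: $\mathbb Z_p$ denotes the $p$-adic integers, $\mathbb Q_p$ the $p$-adic numbers, $\|\cdot\|_p$ the $p$-adic norm; for $a,b\in\mathbb Q_p$, $a\equiv b\pmod{p^s}$ means $\|a-b\|_p\le p^{ -s}$. A function $f\colon\mathbb Z_p\to\mathbb Z_p$ is uniformly differentiable modulo $p^k$ on $\mathbb Z_p$ if there exist $N\in\mathbb N$ and, for each $u\in\mathbb Z_p$, an element $f'_k(u)\in\mathbb Q_p$ (the derivative modulo $p^k$ at $u$) such that for every integer $K\ge N$, every $u\in\mathbb Z_p$ and every $h\in\mathbb Z_p$ with $\|h\|_p\le p^{ -K}$ one has $f(u+h)\equiv f(u)+hf'_k(u)\pmod{p^{k+K}}$. For $k\ge1$, $f\bmod p^k$ denotes the map $\{0,1,\dots,p^k-1\}\to\mathbb Z/p^k$, $x\mapsto f(x)\bmod p^k$. $f$ is asymptotically measure-preserving if $f\bmod p^k$ is a bijection onto $\mathbb Z/p^k$ (identified with $\{0,\dots,p^k-1\}$) for all sufficiently large $k$. -}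

module Defs where

open import Data.Nat as ℕ using (ℕ; zero; suc; NonZero; _≥_)
open import Data.Nat.Properties using (m^n≢0)
open import Data.Integer as ℤ using (ℤ; +_; _-_)
open import Data.Integer.DivMod using (_%ℕ_; n%ℕd<d)
open import Data.Integer.Divisibility.Signed
  using (_∣_; ∣m∣n⇒∣m+n; ∣n⇒∣m*n; ∣m⇒∣m*n; ∣-refl)
open import Data.Integer.Tactic.RingSolver using (solve-∀)
open import Data.Fin as Fin using (Fin; toℕ; fromℕ<)
open import Data.Product using (Σ; ∃; _×_; _,_)
open import Function.Definitions using (Bijective)
open import Relation.Binary.PropositionalEquality using (_≡_; refl; subst; sym)
open import Relation.Nullary using (¬_)

-- p-adic integers, as coherent sequences of integer approximations:
-- seq k is an approximation of the p-adic integer modulo p^k, i.e.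
-- seq (suc k) ≡ seq k (mod p^k).  (Representatives need not be reduced.)

record ℤₚ (p : ℕ) : Set where
  constructor mkℤₚ
  field
    seq : ℕ → ℤ
    coh : ∀ k → (+ (p ℕ.^ k)) ∣ (seq (suc k) - seq k)
open ℤₚ public

module _ {p : ℕ} where

  private
    +-lem : ∀ a b c d → (a ℤ.+ b) - (c ℤ.+ d) ≡ (a - c) ℤ.+ (b - d)
    +-lem = solve-∀
    *-lem : ∀ a b c d → (a ℤ.* b) - (c ℤ.* d) ≡ a ℤ.* (b - d) ℤ.+ (a - c) ℤ.* d
    *-lem = solve-∀

  _+ₚ_ : ℤₚ p → ℤₚ p → ℤₚ p
  x +ₚ y = mkℤₚ (λ k → seq x k ℤ.+ seq y k)
    (λ k → subst (_ ∣_) (sym (+-lem (seq x (suc k)) (seq y (suc k)) (seq x k) (seq y k)))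
                 (∣m∣n⇒∣m+n (coh x k) (coh y k)))

  _*ₚ_ : ℤₚ p → ℤₚ p → ℤₚ p
  x *ₚ y = mkℤₚ (λ k → seq x k ℤ.* seq y k)
    (λ k → subst (_ ∣_) (sym (*-lem (seq x (suc k)) (seq y (suc k)) (seq x k) (seq y k)))
                 (∣m∣n⇒∣m+n (∣n⇒∣m*n (seq x (suc k)) (coh y k))
                            (∣m⇒∣m*n (seq y k) (coh x k))))

ι : (p : ℕ) → ℕ → ℤₚ p
ι p n = mkℤₚ (λ _ → + n) (λ k → subst (_ ∣_) (sym (ℤ.i≡j⇒i-j≡0 {+ n} refl)) (record { quotient = + 0 ; equality = refl }))
  where import Data.Integer.Properties as ℤ

_≡ₚ_[mod^_] : {p : ℕ} → ℤₚ p → ℤₚ p → ℕ → Set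
_≡ₚ_[mod^_] {p} a b s = (+ (p ℕ.^ s)) ∣ (seq a s - seq b s)

_≈ₚ_ : {p : ℕ} → ℤₚ p → ℤₚ p → Set
a ≈ₚ b = ∀ s → a ≡ₚ b [mod^ s ]

-- p-adic numbers: num / p^den  with num ∈ ℤₚ, den ∈ ℕ  (ℚₚ = ℤₚ[1/p])

record ℚₚ (p : ℕ) : Set where
  constructor _/p^_
  field
    num : ℤₚ p
    den : ℕ
open ℚₚ public

module _ {p : ℕ} where

  ⟦_⟧ : ℤₚ p → ℚₚ p
  ⟦ a ⟧ = a /p^ 0

  _+q_ : ℚₚ p → ℚₚ p → ℚₚ p
  (a /p^ m) +q (b /p^ n) = ((a *ₚ ι p (p ℕ.^ n)) +ₚ (b *ₚ ι p (p ℕ.^ m))) /p^ (m ℕ.+ n)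

  _*q_ : ℚₚ p → ℚₚ p → ℚₚ p
  (a /p^ m) *q (b /p^ n) = (a *ₚ b) /p^ (m ℕ.+ n)

  _≡q_[mod^_] : ℚₚ p → ℚₚ p → ℕ → Set
  (a /p^ m) ≡q (b /p^ n) [mod^ s ] =
    (a *ₚ ι p (p ℕ.^ n)) ≡ₚ (b *ₚ ι p (p ℕ.^ m)) [mod^ (s ℕ.+ m ℕ.+ n) ]

  -- ‖ x ‖_p ≥ 1  (norm values are 0 or integer powers of p, so this is ¬ ‖x‖_p ≤ p^{-1})
  NormGe1 : ℚₚ p → Set
  NormGe1 x = ¬ (x ≡q ⟦ ι p 0 ⟧ [mod^ 1 ])

Respects≈ : {p : ℕ} → (ℤₚ p → ℤₚ p) → Set
Respects≈ f = ∀ u v → u ≈ₚ v → f u ≈ₚ f v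

IsUnifDiffMod : {p : ℕ} → (f : ℤₚ p → ℤₚ p) → (k N : ℕ) → (f' : ℤₚ p → ℚₚ p) → Set
IsUnifDiffMod {p} f k N f' =
  ∀ (K : ℕ) → K ≥ N → ∀ (u h : ℤₚ p) → h ≡ₚ ι p 0 [mod^ K ] →
    ⟦ f (u +ₚ h) ⟧ ≡q (⟦ f u ⟧ +q (⟦ h ⟧ *q f' u)) [mod^ (k ℕ.+ K) ]

fmod : (p : ℕ) .{{_ : NonZero p}} → (ℤₚ p → ℤₚ p) → (k : ℕ) → Fin (p ℕ.^ k) → Fin (p ℕ.^ k)
fmod p f k x = fromℕ< (n%ℕd<d (seq (f (ι p (toℕ x))) k) (p ℕ.^ k) {{m^n≢0 p k}})

AsympMeasurePreserving : (p : ℕ) .{{_ : NonZero p}} → (ℤₚ p → ℤₚ p) → Set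
AsympMeasurePreserving p f =
  ∃ λ (M : ℕ) → ∀ k → k ≥ M → Bijective _≡_ _≡_ (fmod p f k)

-- If f'(u) = a / p^m is ≡ 0 mod p then p^(m+1) ∣ a, so for K ≥ N and v ≡ u mod p^K the
-- differentiability congruence gives f v ≡ f u + (v - u) f'(u) ≡ f u mod p^(K+1), because
-- p^K ∣ v - u.  Hence the residue n of u mod p^K and n + p^K (both below p^(K+1) as p ≥ 2)
-- have the same image under f mod p^(K+1), which is therefore not injective for any K ≥ N.

module Submission where

open import Defs
open import Data.Nat using (ℕ; NonZero)
open import Data.Nat.Primality using (Prime; prime⇒nonTrivial)

open import Data.Nat as ℕ using (suc; _^_; _≤_; _<_)
import Data.Nat.Properties as ℕ
import Data.Nat.Divisibility as ℕ
open import Data.Nat.DivMod using (m<n⇒m%n≡m)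
open import Data.Integer as ℤ using (ℤ; +_; _-_; -_)
import Data.Integer.Properties as ℤ
open import Data.Integer.DivMod using (_%ℕ_; _/ℕ_; n%ℕd<d; a≡a%ℕn+[a/ℕn]*n)
open import Data.Integer.Divisibility.Signed
open import Data.Integer.Tactic.RingSolver using (solve-∀)
open import Data.Fin using (fromℕ<)
import Data.Fin.Properties as Fin
open import Data.Product using (_,_; proj₁)
open import Relation.Binary.PropositionalEquality
open import Relation.Nullary using (¬_)
open import Function.Definitions using (Injective)
open import Relation.Binary.Structures using (IsEquivalence)
open import Relation.Binary.Bundles using (Setoid)
import Relation.Binary.Reasoning.Setoid as SetoidReasoning
open import Level using (0ℓ)

-- A record rather than d ∣ x - y itself, so that x and y can be inferred from a congruence.
infix 4 _≡_[mod_]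
record _≡_[mod_] (x y d : ℤ) : Set where
  constructor ∣-difference
  field divides-difference : d ∣ x - y
open _≡_[mod_]

module _ {d : ℤ} where

  ≡mod-refl : ∀ {x} → x ≡ x [mod d ]
  ≡mod-refl {x} = ∣-difference (subst (d ∣_) (sym (ℤ.+-inverseʳ x)) (∣n⇒∣m*n (+ 0) ∣-refl))

  ≡mod-reflexive : ∀ {x y} → x ≡ y → x ≡ y [mod d ]
  ≡mod-reflexive refl = ≡mod-refl

  ≡mod-sym : ∀ {x y} → x ≡ y [mod d ] → y ≡ x [mod d ]
  ≡mod-sym {x} {y} (∣-difference d∣x-y) = ∣-difference (subst (d ∣_) (negate-difference x y) (∣m⇒∣-m d∣x-y))
    where negate-difference : ∀ a b → - (a - b) ≡ b - a
          negate-difference = solve-∀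

  ≡mod-trans : ∀ {x y z} → x ≡ y [mod d ] → y ≡ z [mod d ] → x ≡ z [mod d ]
  ≡mod-trans {x} {y} {z} (∣-difference d∣x-y) (∣-difference d∣y-z) =
    ∣-difference (subst (d ∣_) (telescope x y z) (∣m∣n⇒∣m+n d∣x-y d∣y-z))
    where telescope : ∀ a b c → (a - b) ℤ.+ (b - c) ≡ a - c
          telescope = solve-∀

  ≡mod-+-absorbʳ : ∀ {x y z} → d ∣ z → x ≡ y ℤ.+ z [mod d ] → x ≡ y [mod d ]
  ≡mod-+-absorbʳ {x} {y} {z} d∣z (∣-difference d∣x-[y+z]) =
    ∣-difference (subst (d ∣_) (add-back x y z) (∣m∣n⇒∣m+n d∣x-[y+z] d∣z))
    where add-back : ∀ a b c → (a - (b ℤ.+ c)) ℤ.+ c ≡ a - b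
          add-back = solve-∀

≡mod-isEquivalence : ∀ d → IsEquivalence (λ x y → x ≡ y [mod d ])
≡mod-isEquivalence d = record { refl = ≡mod-refl ; sym = ≡mod-sym ; trans = ≡mod-trans }

≡mod-setoid : ℤ → Setoid 0ℓ 0ℓ
≡mod-setoid d = record { isEquivalence = ≡mod-isEquivalence d }

module ≡mod-Reasoning (d : ℤ) = SetoidReasoning (≡mod-setoid d)

≡mod-weaken : ∀ {e d x y} → e ∣ d → x ≡ y [mod d ] → x ≡ y [mod e ]
≡mod-weaken e∣d (∣-difference d∣x-y) = ∣-difference (∣-trans e∣d d∣x-y)

≡mod-*-cancelʳ : ∀ {d x y} c .{{_ : ℤ.NonZero c}} → x ℤ.* c ≡ y ℤ.* c [mod d ℤ.* c ] → x ≡ y [mod d ]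
≡mod-*-cancelʳ {d} {x} {y} c (∣-difference dc∣xc-yc) =
  ∣-difference (*-cancelʳ-∣ c (subst (d ℤ.* c ∣_) (factor x y c) dc∣xc-yc))
  where factor : ∀ a b c → a ℤ.* c - b ℤ.* c ≡ (a - b) ℤ.* c
        factor = solve-∀

≡mod-0⇒∣ : ∀ {d x} → x ≡ + 0 [mod d ] → d ∣ x
≡mod-0⇒∣ {d} {x} (∣-difference d∣x-0) = subst (d ∣_) (ℤ.+-identityʳ x) d∣x-0

+[m+n]≡+m[mod+n] : ∀ m n → + (m ℕ.+ n) ≡ + m [mod + n ]
+[m+n]≡+m[mod+n] m n = ∣-difference (subst (+ n ∣_) (sym n≡[m+n]-m) ∣-refl)
  where
  cancel : ∀ a b → (a ℤ.+ b) - a ≡ b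
  cancel = solve-∀
  n≡[m+n]-m : + (m ℕ.+ n) - + m ≡ + n
  n≡[m+n]-m = trans (cong (_- + m) (ℤ.pos-+ m n)) (cancel (+ m) (+ n))

m<n⇒m+n<o*n : ∀ {m n o} → m < n → 2 ≤ o → m ℕ.+ n < o ℕ.* n
m<n⇒m+n<o*n {m} {n} {o} m<n 2≤o = ℕ.<-≤-trans (ℕ.+-monoˡ-< n m<n)
  (subst (ℕ._≤ o ℕ.* n) (cong (n ℕ.+_) (ℕ.+-identityʳ n)) (ℕ.*-monoˡ-≤ n 2≤o))

module _ {d : ℕ} .{{_ : NonZero d}} where

  residue-unique : ∀ {a b} → a < d → b < d → + a ≡ + b [mod + d ] → a ≡ b
  residue-unique {a} {b} a<d b<d (∣-difference d∣a-b) =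
    ℤ.+-injective (ℤ.i-j≡0⇒i≡j (+ a) (+ b) (ℤ.∣i∣≡0⇒i≡0 ∣a-b∣≡0))
    where
    ∣a-b∣<d : ℤ.∣ + a - + b ∣ < d
    ∣a-b∣<d = ℕ.<-≤-trans
      (ℕ.s≤s (subst (_≤ a ℕ.⊔ b) (cong ℤ.∣_∣ (sym (ℤ.m-n≡m⊖n a b))) (ℤ.∣m⊝n∣≤m⊔n a b)))
      (ℕ.⊔-lub a<d b<d)
    ∣a-b∣≡0 : ℤ.∣ + a - + b ∣ ≡ 0
    ∣a-b∣≡0 = trans (sym (m<n⇒m%n≡m ∣a-b∣<d)) (ℕ.n∣m⇒m%n≡0 _ d (∣⇒∣ᵤ d∣a-b))

  %ℕ-≡mod : ∀ x → + (x %ℕ d) ≡ x [mod + d ]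
  %ℕ-≡mod x = ≡mod-sym (∣-difference (subst (+ d ∣_) (sym x-r≡q*d) (∣n⇒∣m*n (x /ℕ d) ∣-refl)))
    where
    open ≡-Reasoning
    cancel : ∀ a b → (a ℤ.+ b) - a ≡ b
    cancel = solve-∀
    x-r≡q*d : x - + (x %ℕ d) ≡ (x /ℕ d) ℤ.* + d
    x-r≡q*d = begin
      x - + (x %ℕ d)                             ≡⟨ cong (_- + (x %ℕ d)) (a≡a%ℕn+[a/ℕn]*n x d) ⟩
      (+ (x %ℕ d) ℤ.+ (x /ℕ d) ℤ.* + d) - + (x %ℕ d) ≡⟨ cancel (+ (x %ℕ d)) _ ⟩
      (x /ℕ d) ℤ.* + d                           ∎

  ≡mod⇒%ℕ≡ : ∀ {x y} → x ≡ y [mod + d ] → x %ℕ d ≡ y %ℕ d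
  ≡mod⇒%ℕ≡ {x} {y} x≡y = residue-unique (n%ℕd<d x d) (n%ℕd<d y d)
    (≡mod-trans (%ℕ-≡mod x) (≡mod-trans x≡y (≡mod-sym (%ℕ-≡mod y))))

module _ (p : ℕ) where

  +p^[m+n]≡+p^m*+p^n : ∀ m n → + (p ^ (m ℕ.+ n)) ≡ + (p ^ m) ℤ.* + (p ^ n)
  +p^[m+n]≡+p^m*+p^n m n = trans (cong +_ (ℕ.^-distribˡ-+-* p m n)) (ℤ.pos-* (p ^ m) (p ^ n))

  m≤n⇒+p^m∣+p^n : ∀ {m n} → m ≤ n → + (p ^ m) ∣ + (p ^ n)
  m≤n⇒+p^m∣+p^n {m} {n} m≤n = ∣ᵤ⇒∣ (subst (p ^ m ℕ.∣_) p^m*p^[n-m]≡p^n (ℕ.m∣m*n (p ^ (n ℕ.∸ m))))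
    where
    p^m*p^[n-m]≡p^n : p ^ m ℕ.* p ^ (n ℕ.∸ m) ≡ p ^ n
    p^m*p^[n-m]≡p^n = trans (sym (ℕ.^-distribˡ-+-* p m _)) (cong (p ^_) (ℕ.m+[n∸m]≡n m≤n))

  +p^m*+p^[1+n]≡+p^[1+m]*+p^n : ∀ m n → + (p ^ m) ℤ.* + (p ^ suc n) ≡ + (p ^ suc m) ℤ.* + (p ^ n)
  +p^m*+p^[1+n]≡+p^[1+m]*+p^n m n = begin
    + (p ^ m) ℤ.* + (p ^ suc n)       ≡⟨ ℤ.pos-* (p ^ m) (p ^ suc n) ⟨
    + (p ^ m ℕ.* (p ℕ.* p ^ n))       ≡⟨ cong +_ (ℕ.*-assoc (p ^ m) p (p ^ n)) ⟨
    + (p ^ m ℕ.* p ℕ.* p ^ n)         ≡⟨ cong (λ c → + (c ℕ.* p ^ n)) (ℕ.*-comm (p ^ m) p) ⟩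
    + (p ^ suc m ℕ.* p ^ n)           ≡⟨ ℤ.pos-* (p ^ suc m) (p ^ n) ⟩
    + (p ^ suc m) ℤ.* + (p ^ n)       ∎
    where open ≡-Reasoning

module _ {p : ℕ} where

  seq-coherent : ∀ (x : ℤₚ p) {k s} → k ≤ s → seq x s ≡ seq x k [mod + (p ^ k) ]
  seq-coherent x k≤s = go (ℕ.≤⇒≤′ k≤s)
    where
    go : ∀ {k s} → k ℕ.≤′ s → seq x s ≡ seq x k [mod + (p ^ k) ]
    go ℕ.≤′-refl = ≡mod-refl
    go (ℕ.≤′-step {s} k≤′s) =
      ≡mod-trans (≡mod-weaken (m≤n⇒+p^m∣+p^n p (ℕ.≤′⇒≤ k≤′s)) (∣-difference (coh x s))) (go k≤′s)

  ≡ₚ0⇒∣seq : ∀ (x : ℤₚ p) {k s} → k ≤ s → x ≡ₚ ι p 0 [mod^ k ] → + (p ^ k) ∣ seq x s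
  ≡ₚ0⇒∣seq x k≤s x≡0 = ≡mod-0⇒∣ (≡mod-trans (seq-coherent x k≤s) (∣-difference x≡0))

  infixl 6 _-ₚ_
  _-ₚ_ : ℤₚ p → ℤₚ p → ℤₚ p
  x -ₚ y = mkℤₚ (λ k → seq x k - seq y k)
    (λ k → subst (_ ∣_) (regroup (seq x (suc k)) (seq y (suc k)) (seq x k) (seq y k))
                 (∣m∣n⇒∣m-n (coh x k) (coh y k)))
    where regroup : ∀ a b c d → (a - c) - (b - d) ≡ (a - b) - (c - d)
          regroup = solve-∀

  u+ₚ[v-ₚu]≈ₚv : ∀ u v → (u +ₚ (v -ₚ u)) ≈ₚ v
  u+ₚ[v-ₚu]≈ₚv u v k = divides-difference (≡mod-reflexive (cancel (seq u k) (seq v k)))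
    where cancel : ∀ a b → a ℤ.+ (b - a) ≡ b
          cancel = solve-∀

  -ₚ-≡ₚ0 : ∀ (u v : ℤₚ p) {k} → v ≡ₚ u [mod^ k ] → (v -ₚ u) ≡ₚ ι p 0 [mod^ k ]
  -ₚ-≡ₚ0 u v {k} v≡u = subst (+ (p ^ k) ∣_) (sym (ℤ.+-identityʳ _)) v≡u

≡q0⇒num≡ₚ0 : ∀ {p} (x : ℚₚ p) → x ≡q ⟦ ι p 0 ⟧ [mod^ 1 ] → num x ≡ₚ ι p 0 [mod^ suc (den x) ]
≡q0⇒num≡ₚ0 {p} (a /p^ m) a/p^m≡0 =
  subst (λ j → + (p ^ suc j) ∣ seq a (suc j) - + 0) (ℕ.+-identityʳ m)
        (subst (_ ∣_) (drop-units (seq a (suc (m ℕ.+ 0))) (+ (p ^ m))) a/p^m≡0)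
  where drop-units : ∀ x c → x ℤ.* + 1 - + 0 ℤ.* c ≡ x - + 0
        drop-units = solve-∀

module _ {p : ℕ} .{{_ : NonZero p}} (f : ℤₚ p → ℤₚ p) (f' : ℤₚ p → ℚₚ p) {N : ℕ}
         (f-resp : Respects≈ f) (diff : IsUnifDiffMod f 1 N f') where

  f'≡0⇒locally-constant : ∀ u → f' u ≡q ⟦ ι p 0 ⟧ [mod^ 1 ] → ∀ {K} → N ≤ K →
    ∀ v → v ≡ₚ u [mod^ K ] → seq (f v) (suc K) ≡ seq (f u) (suc K) [mod + (p ^ suc K) ]
  f'≡0⇒locally-constant u f'u≡0 {K} N≤K v v≡u = begin
    seq (f v) (suc K)   ≈⟨ ≡mod-sym (seq-coherent (f v) 1+K≤s) ⟩
    seq (f v) s         ≈⟨ ≡mod-weaken (m≤n⇒+p^m∣+p^n p 1+K≤s) f[v]≡f[u+h] ⟩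
    seq (f (u +ₚ h)) s  ≈⟨ increment ⟩
    seq (f u) s         ≈⟨ seq-coherent (f u) 1+K≤s ⟩
    seq (f u) (suc K)   ∎
    where
    open ≡mod-Reasoning (+ (p ^ suc K))
    a : ℤₚ p
    a = num (f' u)
    m : ℕ
    m = den (f' u)
    h : ℤₚ p
    h = v -ₚ u
    s : ℕ
    s = suc K ℕ.+ 0 ℕ.+ m

    f[v]≡f[u+h] : seq (f v) s ≡ seq (f (u +ₚ h)) s [mod + (p ^ s) ]
    f[v]≡f[u+h] = ≡mod-sym (∣-difference (f-resp (u +ₚ h) v (u+ₚ[v-ₚu]≈ₚv u v) s))

    1+K≤s : suc K ≤ s
    1+K≤s = ℕ.≤-trans (ℕ.m≤m+n (suc K) 0) (ℕ.m≤m+n (suc K ℕ.+ 0) m)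

    h≡ₚ0 : h ≡ₚ ι p 0 [mod^ K ]
    h≡ₚ0 = -ₚ-≡ₚ0 u v v≡u

    h-small : + (p ^ K) ∣ seq h s
    h-small = ≡ₚ0⇒∣seq h (ℕ.≤-trans (ℕ.n≤1+n K) 1+K≤s) h≡ₚ0

    a-small : + (p ^ suc m) ∣ seq a s
    a-small = ≡ₚ0⇒∣seq a (ℕ.s≤s (ℕ.m≤n+m m (K ℕ.+ 0))) (≡q0⇒num≡ₚ0 (f' u) f'u≡0)

    derivative-term-small : + (p ^ suc K) ℤ.* + (p ^ m) ∣ seq h s ℤ.* seq a s
    derivative-term-small = subst (_∣ seq h s ℤ.* seq a s) (+p^m*+p^[1+n]≡+p^[1+m]*+p^n p K m)
      (∣-trans (*-monoˡ-∣ (+ (p ^ suc m)) h-small) (*-monoʳ-∣ (seq h s) a-small))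

    p^[1+K]*p^m≡p^s : + (p ^ suc K) ℤ.* + (p ^ m) ≡ + (p ^ s)
    p^[1+K]*p^m≡p^s = sym (trans (cong (λ j → + (p ^ (j ℕ.+ m))) (ℕ.+-identityʳ (suc K)))
                                 (+p^[m+n]≡+p^m*+p^n p (suc K) m))

    drop-units : ∀ x c y → (x ℤ.* c ℤ.+ y ℤ.* + 1) ℤ.* + 1 ≡ x ℤ.* c ℤ.+ y
    drop-units = solve-∀

    -- Differentiability at u with increment h, cleared of the denominator of f'(u) = a / p^m.
    expansion : seq (f (u +ₚ h)) s ℤ.* + (p ^ m)
              ≡ seq (f u) s ℤ.* + (p ^ m) ℤ.+ seq h s ℤ.* seq a s [mod + (p ^ suc K) ℤ.* + (p ^ m) ]
    expansion = ≡mod-weaken (∣-reflexive p^[1+K]*p^m≡p^s)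
      (subst (λ z → seq (f (u +ₚ h)) s ℤ.* + (p ^ m) ≡ z [mod + (p ^ s) ])
             (drop-units (seq (f u) s) (+ (p ^ m)) (seq h s ℤ.* seq a s))
             (∣-difference (diff K N≤K u h h≡ₚ0)))

    increment : seq (f (u +ₚ h)) s ≡ seq (f u) s [mod + (p ^ suc K) ]
    increment = ≡mod-*-cancelʳ (+ (p ^ m)) {{ℕ.m^n≢0 p m}}
      (≡mod-+-absorbʳ derivative-term-small expansion)

module _ {p : ℕ} .{{_ : NonZero p}} (f : ℤₚ p → ℤₚ p) where

  fmod-fromℕ<-cong : ∀ {k m n} (m<p^k : m < p ^ k) (n<p^k : n < p ^ k) →
    seq (f (ι p m)) k ≡ seq (f (ι p n)) k [mod + (p ^ k) ] →
    fmod p f k (fromℕ< m<p^k) ≡ fmod p f k (fromℕ< n<p^k)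
  fmod-fromℕ<-cong {k} m<p^k n<p^k fm≡fn
    rewrite Fin.toℕ-fromℕ< m<p^k | Fin.toℕ-fromℕ< n<p^k =
      Fin.fromℕ<-cong _ _ (≡mod⇒%ℕ≡ {{ℕ.m^n≢0 p k}} fm≡fn) _ _

  locally-constant⇒¬injective : 2 ≤ p → ∀ u K →
    (∀ v → v ≡ₚ u [mod^ K ] → seq (f v) (suc K) ≡ seq (f u) (suc K) [mod + (p ^ suc K) ]) →
    ¬ Injective _≡_ _≡_ (fmod p f (suc K))
  locally-constant⇒¬injective 2≤p u K locally-constant injective =
    ℕ.<⇒≢ (ℕ.m<m+n n (ℕ.m^n>0 p K)) n≡n+p^K
    where
    instance
      p^K≢0 : NonZero (p ^ K)
      p^K≢0 = ℕ.m^n≢0 p K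
    n : ℕ
    n = seq u K %ℕ p ^ K

    n<p^K : n < p ^ K
    n<p^K = n%ℕd<d (seq u K) (p ^ K)

    n<p^[1+K] : n < p ^ suc K
    n<p^[1+K] = ℕ.<-≤-trans n<p^K (ℕ.m≤n*m (p ^ K) p)

    n+p^K<p^[1+K] : n ℕ.+ p ^ K < p ^ suc K
    n+p^K<p^[1+K] = m<n⇒m+n<o*n n<p^K 2≤p

    n≡u : + n ≡ seq u K [mod + (p ^ K) ]
    n≡u = %ℕ-≡mod (seq u K)

    n+p^K≡u : + (n ℕ.+ p ^ K) ≡ seq u K [mod + (p ^ K) ]
    n+p^K≡u = ≡mod-trans (+[m+n]≡+m[mod+n] n (p ^ K)) n≡u

    collision : seq (f (ι p n)) (suc K) ≡ seq (f (ι p (n ℕ.+ p ^ K))) (suc K) [mod + (p ^ suc K) ]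
    collision = ≡mod-trans (locally-constant (ι p n) (divides-difference n≡u))
                           (≡mod-sym (locally-constant (ι p (n ℕ.+ p ^ K)) (divides-difference n+p^K≡u)))

    n≡n+p^K : n ≡ n ℕ.+ p ^ K
    n≡n+p^K = Fin.fromℕ<-injective n (n ℕ.+ p ^ K) n<p^[1+K] n+p^K<p^[1+K]
      (injective (fmod-fromℕ<-cong n<p^[1+K] n+p^K<p^[1+K] collision))

proposition3p2 : (p : ℕ) → Prime p → .{{_ : NonZero p}} →
    (f : ℤₚ p → ℤₚ p) → Respects≈ f →
    (N : ℕ) (f'₁ : ℤₚ p → ℚₚ p) → IsUnifDiffMod f 1 N f'₁ →
    AsympMeasurePreserving p f →
    ∀ (u : ℤₚ p) → NormGe1 (f'₁ u)
proposition3p2 p p-prime f f-resp N f'₁ diff (M , bijective) u f'u≡0 =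
  locally-constant⇒¬injective f 2≤p u K
    (f'≡0⇒locally-constant f f'₁ f-resp diff u f'u≡0 (ℕ.m≤m+n N M))
    (proj₁ (bijective (suc K) (ℕ.m≤n⇒m≤1+n (ℕ.m≤n+m M N))))
  where
  K : ℕ
  K = N ℕ.+ M
  2≤p : 2 ≤ p
  2≤p = ℕ.nonTrivial⇒n>1 p {{prime⇒nonTrivial p-prime}}
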